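{- If $\mathbb{G} = (\mathbb{X}_S, \mathbb{X}_P, R_\Diamond, R_\lozenge)$ is a heterogeneous $\mathbf{A}$-frame, then its complex algebra $\mathbb{G}^+ = (\mathbb{X}_S^+,\mathbb{X}_P^+, \langle R_\lozenge\rangle, \langle R_\Diamond\rangle)$ is such that $\mathbb{X}_S^+$ and $\mathbb{X}_P^+$ are complete lattices, and $\langle R_\lozenge\rangle$ and $\langle R_\Diamond\rangle$ are completely join-preserving.
   Context: $\mathbf{A} = (D, 1, 0, \vee, \wedge, \otimes, \to)$ is a fixed complete, frame-distributive and dually frame-distributive, commutative and associative residuated lattice. For a set $W$, $\mathbf{A}$-subsets of $W$ are maps $W\to\mathbf{A}$, ordered pointwise ($\subseteq$); for $\beta\in\mathbf{A}$ and $w\in W$, $\{\beta/w\}$ maps $w$ to $\beta$ and every other element to $0$. A reflexive $\mathbf{A}$-graph is $\mathbb{X}=(Z,E)$ with $E: Z\times Z\to\mathbf{A}$ and $E(z,z)=1$ for all $z$. Put $Z_A:=\mathbf{A}\times Z$, $Z_X:=Z$. For $f: Z_A\to\mathbf{A}$ and $u: Z_X\to\mathbf{A}$ define $u^{[0]}(\alpha,z)=\bigwedge_{z'\in Z}[u(z')\to(E(z,z')\to\alpha)]$ and $f^{[1]}(z)=\bigwedge_{(\alpha,z')\in Z_A}[f(\alpha,z')\to(E(z',z)\to\alpha)]$ (these are the Galois maps of the formal $\mathbf{A}$-context $(Z_A,Z_X,I_E)$ with $I_E((\alpha,z),z')=E(z,z')\to\alpha$). $\mathbb{X}^+$ is the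 set of pairs $c=([\![c]\!],(\![c]\!))$ with $[\![c]\!]:Z_A\to\mathbf{A}$, $(\![c]\!):Z_X\to\mathbf{A}$, $[\![c]\!]^{[1]}=(\![c]\!)$ and $(\![c]\!)^{[0]}=[\![c]\!]$, ordered by $c\le d$ iff $[\![c]\!]\subseteq[\![d]\!]$. A heterogeneous $\mathbf{A}$-frame is $\mathbb{G}=(\mathbb{X}_S,\mathbb{X}_P,R_\Diamond,R_\lozenge)$ with $\mathbb{X}_S=(Z^S,E_S)$, $\mathbb{X}_P=(Z^P,E_P)$ reflexive $\mathbf{A}$-graphs, $R_\lozenge: Z^S\times Z^P\to\mathbf{A}$, $R_\Diamond: Z^P\times Z^S\to\mathbf{A}$. For $f:\mathbf{A}\times Z^S\to\mathbf{A}$, $u:Z^P\to\mathbf{A}$: $R_\Diamond^{[0]}[f](z)=\bigwedge_{(\alpha,z')\in \mathbf{A}\times Z^S}[f(\alpha,z')\to(R_\Diamond(z,z')\to\alpha)]$ ($z\in Z^P$) and $R_\Diamond^{[1]}[u](\alpha,w)=\bigwedge_{z'\in Z^P}[u(z')\to(R_\Diamond(z',w)\to\alpha)]$ ($w\in Z^S$); symmetrically, for $f:\mathbf{A}\times Z^P\to\mathbf{A}$, $u:Z^S\to\mathbf{A}$: $R_\lozenge^{[0]}[f](z)=\bigwedge_{(\alpha,z')\in\mathbf{A}\times Z^P}[f(\alpha,z')\to(R_\lozenge(z,z')\to\alpha)]$ ($z\in Z^S$), $R_\lozenge^{[1]}[u](\alpha,w)=\bigwedge_{z'\in Z^S}[u(z')\to(R_\lozenge(z',w)\to\alpha)]$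 ($w\in Z^P$). The relations are required to satisfy, for all appropriately typed states and all $\alpha,\beta\in\mathbf{A}$: $(R_\Diamond^{[0]}[\{\beta/(\alpha,z)\}])^{[01]}\subseteq R_\Diamond^{[0]}[\{\beta/(\alpha,z)\}]$, $(R_\Diamond^{[1]}[\{\beta/z'\}])^{[10]}\subseteq R_\Diamond^{[1]}[\{\beta/z'\}]$, and the same two inclusions for $R_\lozenge$ (where $(\cdot)^{[01]}=((\cdot)^{[0]})^{[1]}$, $(\cdot)^{[10]}=((\cdot)^{[1]})^{[0]}$). The complex algebra is $\mathbb{G}^+=(\mathbb{X}_S^+,\mathbb{X}_P^+,\langle R_\lozenge\rangle,\langle R_\Diamond\rangle)$ with, for $c\in\mathbb{X}_S^+$ and $d\in\mathbb{X}_P^+$, $\langle R_\Diamond\rangle c=((R_\Diamond^{[0]}[[\![c]\!]])^{[0]},R_\Diamond^{[0]}[[\![c]\!]])$ and $\langle R_\lozenge\rangle d=((R_\lozenge^{[0]}[[\![d]\!]])^{[0]},R_\lozenge^{[0]}[[\![d]\!]])$. -}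

module Defs where

open import Level using (Level; _⊔_) renaming (suc to lsuc; zero to lzero)
open import Data.Product using (Σ; _×_; _,_; proj₁; proj₂)
open import Relation.Binary.PropositionalEquality using (_≡_)
open import Relation.Binary.Structures using (IsPartialOrder)
open import Function.Bundles using (_⇔_)

record CRL : Set₁ where
  infixr 6 _∨_
  infixr 7 _∧_
  infixr 7 _⊗_
  infixr 5 _⇒_
  infix 4 _≤_
  field
    D   : Set
    𝟙   : D
    𝟘   : D
    _∨_ : D → D → D
    _∧_ : D → D → D
    _⊗_ : D → D → D
    _⇒_ : D → D → D
    ⋁   : {I : Set} → (I → D) → D
    ⋀   : {I : Set} → (I → D) → D
    _≤_ : D → D → Set
    ≤-isPartialOrder : IsPartialOrder _≡_ _≤_
    ∨-ub₁ : ∀ x y → x ≤ x ∨ y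
    ∨-ub₂ : ∀ x y → y ≤ x ∨ y
    ∨-least : ∀ x y z → x ≤ z → y ≤ z → x ∨ y ≤ z
    ∧-lb₁ : ∀ x y → x ∧ y ≤ x
    ∧-lb₂ : ∀ x y → x ∧ y ≤ y
    ∧-greatest : ∀ x y z → z ≤ x → z ≤ y → z ≤ x ∧ y
    𝟘-least : ∀ x → 𝟘 ≤ x
    ⋁-ub : ∀ {I : Set} (f : I → D) (i : I) → f i ≤ ⋁ f
    ⋁-least : ∀ {I : Set} (f : I → D) (z : D) → (∀ i → f i ≤ z) → ⋁ f ≤ z
    ⋀-lb : ∀ {I : Set} (f : I → D) (i : I) → ⋀ f ≤ f i
    ⋀-greatest : ∀ {I : Set} (f : I → D) (z : D) → (∀ i → z ≤ f i) → z ≤ ⋀ f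
    frame-distrib : ∀ {I : Set} (x : D) (f : I → D) → x ∧ ⋁ f ≡ ⋁ (λ i → x ∧ f i)
    dual-frame-distrib : ∀ {I : Set} (x : D) (f : I → D) → x ∨ ⋀ f ≡ ⋀ (λ i → x ∨ f i)
    ⊗-assoc : ∀ x y z → (x ⊗ y) ⊗ z ≡ x ⊗ (y ⊗ z)
    ⊗-comm  : ∀ x y → x ⊗ y ≡ y ⊗ x
    ⊗-identityˡ : ∀ x → 𝟙 ⊗ x ≡ x
    residuation : ∀ x y z → (x ⊗ y ≤ z) ⇔ (y ≤ x ⇒ z)

module _ (A : CRL) where
  open CRL A

  _⊆_ : {W : Set} → (W → D) → (W → D) → Set
  f ⊆ g = ∀ w → f w ≤ g w

  _≐_ : {W : Set} → (W → D) → (W → D) → Set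
  f ≐ g = ∀ w → f w ≡ g w

  -- {β/w}: maps w to β and everything else to 0.  Written constructively
  -- (no decidable equality on W needed) as the join of β over proofs of
  -- w ≡ w'; this is β if w' = w and 0 (empty join) otherwise.
  sing : {W : Set} → D → W → (W → D)
  sing β w w' = ⋁ {w ≡ w'} (λ _ → β)

  record Graph : Set₁ where
    field
      Z     : Set
      E     : Z → Z → D
      E-refl : ∀ z → E z z ≡ 𝟙

  module _ (X : Graph) where
    open Graph X

    ZA : Set
    ZA = D × Z

    ZX : Set
    ZX = Z

    up0 : (ZX → D) → (ZA → D)
    up0 u (α , z) = ⋀ (λ (z' : Z) → u z' ⇒ (E z z' ⇒ α))

    up1 : (ZA → D) → (ZX → D)
    up1 f z = ⋀ (λ (p : ZA) → f p ⇒ (E (proj₂ p) z ⇒ proj₁ p))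

    record Plus : Set where
      constructor mkPlus
      field
        ext : ZA → D
        int : ZX → D
        ext1 : up1 ext ≐ int
        int0 : up0 int ≐ ext

    open Plus public

    IsPlus : (ZA → D) × (ZX → D) → Set
    IsPlus (f , u) = (up1 f ≐ u) × (up0 u ≐ f)

    toPlus : (p : (ZA → D) × (ZX → D)) → IsPlus p → Plus
    toPlus (f , u) (h₁ , h₂) = mkPlus f u h₁ h₂

    _≤⁺_ : Plus → Plus → Set
    c ≤⁺ d = ext c ⊆ ext d

    _≈⁺_ : Plus → Plus → Set
    c ≈⁺ d = (ext c ≐ ext d) × (int c ≐ int d)

  R0 : {Z₁ Z₂ : Set} → (Z₁ → Z₂ → D) → (D × Z₂ → D) → (Z₁ → D)
  R0 R f z = ⋀ (λ (p : D × _) → f p ⇒ (R z (proj₂ p) ⇒ proj₁ p))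

  R1 : {Z₁ Z₂ : Set} → (Z₁ → Z₂ → D) → (Z₁ → D) → (D × Z₂ → D)
  R1 R u (α , w) = ⋀ (λ z' → u z' ⇒ (R z' w ⇒ α))

  record HFrame : Set₁ where
    field
      XS : Graph
      XP : Graph
    ZS = Graph.Z XS
    ZP = Graph.Z XP
    field
      R◆ : ZP → ZS → D    -- R_Diamond : Z^P × Z^S → A
      R◇ : ZS → ZP → D    -- R_lozenge : Z^S × Z^P → A
      R◆-cond0 : ∀ (β α : D) (z : ZS) →
        up1 XP (up0 XP (R0 R◆ (sing β (α , z)))) ⊆ R0 R◆ (sing β (α , z))
      R◆-cond1 : ∀ (β : D) (z' : ZP) →
        up0 XS (up1 XS (R1 R◆ (sing β z'))) ⊆ R1 R◆ (sing β z')
      R◇-cond0 : ∀ (β α : D) (z : ZP) →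
        up1 XS (up0 XS (R0 R◇ (sing β (α , z)))) ⊆ R0 R◇ (sing β (α , z))
      R◇-cond1 : ∀ (β : D) (z' : ZS) →
        up0 XP (up1 XP (R1 R◇ (sing β z'))) ⊆ R1 R◇ (sing β z')

  ⟨R◆⟩ : (G : HFrame) → Plus (HFrame.XS G) → (ZA (HFrame.XP G) → D) × (ZX (HFrame.XP G) → D)
  ⟨R◆⟩ G c = up0 (HFrame.XP G) (R0 (HFrame.R◆ G) (Plus.ext c)) , R0 (HFrame.R◆ G) (Plus.ext c)

  ⟨R◇⟩ : (G : HFrame) → Plus (HFrame.XP G) → (ZA (HFrame.XS G) → D) × (ZX (HFrame.XS G) → D)
  ⟨R◇⟩ G d = up0 (HFrame.XS G) (R0 (HFrame.R◇ G) (Plus.ext d)) , R0 (HFrame.R◇ G) (Plus.ext d)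

module _ {C : Set} (_≤_ : C → C → Set) where

  IsLub : {I : Set} → (I → C) → C → Set
  IsLub c s = (∀ i → c i ≤ s) × (∀ u → (∀ i → c i ≤ u) → s ≤ u)

  IsGlb : {I : Set} → (I → C) → C → Set
  IsGlb c s = (∀ i → s ≤ c i) × (∀ u → (∀ i → u ≤ c i) → u ≤ s)

IsCompleteLattice : {C : Set} → (C → C → Set) → (C → C → Set) → Set₁
IsCompleteLattice {C} _≈_ _≤_ =
  IsPartialOrder _≈_ _≤_ ×
  ((I : Set) (c : I → C) → Σ C (λ s → IsLub _≤_ c s)) ×
  ((I : Set) (c : I → C) → Σ C (λ s → IsGlb _≤_ c s))

CompletelyJoinPreserving : {C C' : Set} → (C → C → Set) → (C' → C' → Set) → (C → C') → Set₁
CompletelyJoinPreserving {C} _≤_ _≤'_ f =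
  (I : Set) (c : I → C) (s : C) → IsLub _≤_ c s → IsLub _≤'_ (λ i → f (c i)) (f s)

module Submission where

-- Everything rests on one fact about a relation R : Z₁ → Z₂ → A: the maps
-- R⁰ and R¹ form an antitone Galois connection between A-subsets of A × Z₂
-- and A-subsets of Z₁ (u ⊆ R⁰[f] iff f ⊆ R¹[u]).  For a reflexive A-graph
-- the maps (·)^[0], (·)^[1] are such a pair (for the relation E read
-- backwards), so X⁺ is the lattice of Galois-stable pairs: joins are
-- generated by intersecting intents, meets by intersecting extents.
--
-- For the operators, the frame conditions on singletons extend to arbitrary
-- A-subsets, since every f is the join of the singletons {f(p)/p} below it;
-- hence every R⁰[f] is a stable intent and every R¹[u] a stable extent.  The
-- first fact makes ⟨R⟩c a well-defined element; the second makes v ↦ (the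
-- element with extent R¹[(v)]) a map back, and by the Galois connection it is
-- right adjoint to ⟨R⟩, so ⟨R⟩ preserves all joins.

open import Defs
open import Data.Product using (Σ; _×_; _,_; proj₁; proj₂)
open import Relation.Binary.PropositionalEquality using (refl; sym; trans)
open import Relation.Binary.Structures using (IsPartialOrder)
open import Function.Bundles using (Equivalence)

module ComplexAlgebra (A : CRL) where
  open CRL A
  open IsPartialOrder ≤-isPartialOrder using (antisym)
    renaming (refl to ≤-refl; trans to ≤-trans; reflexive to ≤-reflexive)

  infix 4 _⊑_
  _⊑_ : {W : Set} → (W → D) → (W → D) → Set
  _⊑_ = _⊆_ A

  ⊑-trans : {W : Set} {f g h : W → D} → f ⊑ g → g ⊑ h → f ⊑ h
  ⊑-trans f⊑g g⊑h w = ≤-trans (f⊑g w) (g⊑h w)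

  ≐⇒⊑ : {W : Set} {f g : W → D} → _≐_ A f g → f ⊑ g
  ≐⇒⊑ f≐g w = ≤-reflexive (f≐g w)

  ⇒-exchange : ∀ {a b c} → a ≤ b ⇒ c → b ≤ a ⇒ c
  ⇒-exchange {a} {b} {c} h =
    Equivalence.to (residuation a b c)
      (≤-trans (≤-reflexive (⊗-comm a b)) (Equivalence.from (residuation b a c) h))

  ⇒-antitoneˡ : ∀ {a a' b} → a ≤ a' → a' ⇒ b ≤ a ⇒ b
  ⇒-antitoneˡ a≤a' = ⇒-exchange (≤-trans a≤a' (⇒-exchange ≤-refl))

  ⋀-mono : ∀ {I : Set} {f g : I → D} → (∀ i → f i ≤ g i) → ⋀ f ≤ ⋀ g
  ⋀-mono {f = f} {g} f≤g = ⋀-greatest g _ (λ i → ≤-trans (⋀-lb f i) (f≤g i))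

  sing-⊑ : {W : Set} (f : W → D) (p : W) → sing A (f p) p ⊑ f
  sing-⊑ f p q = ⋁-least _ _ (λ { refl → ≤-refl })

  sing-at : {W : Set} (β : D) (p : W) → β ≤ sing A β p p
  sing-at β p = ⋁-ub (λ _ → β) refl

  module Polarity {Z₁ Z₂ : Set} (R : Z₁ → Z₂ → D) where

    ⊑R0⇒⊑R1 : ∀ {f : D × Z₂ → D} {u : Z₁ → D} → u ⊑ R0 A R f → f ⊑ R1 A R u
    ⊑R0⇒⊑R1 u⊑ (α , w) = ⋀-greatest _ _ (λ z → ⇒-exchange (≤-trans (u⊑ z) (⋀-lb _ (α , w))))

    ⊑R1⇒⊑R0 : ∀ {f : D × Z₂ → D} {u : Z₁ → D} → f ⊑ R1 A R u → u ⊑ R0 A R f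
    ⊑R1⇒⊑R0 f⊑ z = ⋀-greatest _ _ (λ p → ⇒-exchange (≤-trans (f⊑ p) (⋀-lb _ z)))

    R0-antitone : ∀ {f g : D × Z₂ → D} → f ⊑ g → R0 A R g ⊑ R0 A R f
    R0-antitone f⊑g z = ⋀-mono (λ p → ⇒-antitoneˡ (f⊑g p))

    R1-antitone : ∀ {u v : Z₁ → D} → u ⊑ v → R1 A R v ⊑ R1 A R u
    R1-antitone u⊑v (α , w) = ⋀-mono (λ z → ⇒-antitoneˡ (u⊑v z))

    R1R0-extensive : ∀ {f : D × Z₂ → D} → f ⊑ R1 A R (R0 A R f)
    R1R0-extensive = ⊑R0⇒⊑R1 (λ _ → ≤-refl)

    R0R1-extensive : ∀ {u : Z₁ → D} → u ⊑ R0 A R (R1 A R u)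
    R0R1-extensive = ⊑R1⇒⊑R0 (λ _ → ≤-refl)

    R1R0R1 : ∀ (u : Z₁ → D) → _≐_ A (R1 A R (R0 A R (R1 A R u))) (R1 A R u)
    R1R0R1 u p = antisym (R1-antitone R0R1-extensive p) (R1R0-extensive p)

    R0R1R0 : ∀ (f : D × Z₂ → D) → _≐_ A (R0 A R (R1 A R (R0 A R f))) (R0 A R f)
    R0R1R0 f z = antisym (R0-antitone R1R0-extensive z) (R0R1-extensive z)

    R0-sing : ∀ β (p : D × Z₂) z →
      R0 A R (sing A β p) z ≤ β ⇒ (R z (proj₂ p) ⇒ proj₁ p)
    R0-sing β p z = ≤-trans (⋀-lb _ p) (⇒-antitoneˡ (sing-at β p))

    R1-sing : ∀ β (z : Z₁) (α : D) w → R1 A R (sing A β z) (α , w) ≤ β ⇒ (R z w ⇒ α)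
    R1-sing β z α w = ≤-trans (⋀-lb _ z) (⇒-antitoneˡ (sing-at β z))

  -- The lattice X⁺ of a reflexive A-graph.  Its Galois maps (·)^[0] and
  -- (·)^[1] are, definitionally, R¹ and R⁰ for the relation E read backwards.
  module Concepts (X : Graph A) where
    open Graph X
    open Polarity (λ z z' → E z' z) public
      using ()
      renaming ( ⊑R0⇒⊑R1 to ⊑up1⇒⊑up0
               ; R0-antitone to up1-antitone ; R1-antitone to up0-antitone
               ; R1R0-extensive to up0up1-extensive ; R0R1-extensive to up1up0-extensive
               ; R1R0R1 to up0up1up0 ; R0R1R0 to up1up0up1 )

    _≤ᶜ_ : Plus A X → Plus A X → Set
    _≤ᶜ_ = _≤⁺_ A X

    up1up0-mono : ∀ {u v : ZX A X → D} → u ⊑ v → up1 A X (up0 A X u) ⊑ up1 A X (up0 A X v)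
    up1up0-mono u⊑v = up1-antitone (up0-antitone u⊑v)

    up0up1-mono : ∀ {f g : ZA A X → D} → f ⊑ g → up0 A X (up1 A X f) ⊑ up0 A X (up1 A X g)
    up0up1-mono f⊑g = up0-antitone (up1-antitone f⊑g)

    int-antitone : ∀ (c d : Plus A X) → c ≤ᶜ d → int d ⊑ int c
    int-antitone c d c≤d =
      ⊑-trans (≐⇒⊑ (λ z → sym (ext1 d z))) (⊑-trans (up1-antitone c≤d) (≐⇒⊑ (ext1 c)))

    ≤ᶜ-by-int : ∀ (c d : Plus A X) → int d ⊑ int c → c ≤ᶜ d
    ≤ᶜ-by-int c d d⊑c =
      ⊑-trans (≐⇒⊑ (λ p → sym (int0 c p))) (⊑-trans (up0-antitone d⊑c) (≐⇒⊑ (int0 d)))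

    closedInt-isPlus : ∀ {u : ZX A X → D} → up1 A X (up0 A X u) ⊑ u → IsPlus A X (up0 A X u , u)
    closedInt-isPlus closed = (λ z → antisym (closed z) (up1up0-extensive z)) , (λ _ → refl)

    closedExt : (f : ZA A X → D) → up0 A X (up1 A X f) ⊑ f → Plus A X
    closedExt f closed = mkPlus f (up1 A X f) (λ _ → refl)
      (λ p → antisym (closed p) (up0up1-extensive p))

    fromInt : (ZX A X → D) → Plus A X
    fromInt u = mkPlus (up0 A X u) (up1 A X (up0 A X u)) (λ _ → refl) (up0up1up0 u)

    ≤-fromInt : ∀ {u} (c : Plus A X) → u ⊑ int c → c ≤ᶜ fromInt u
    ≤-fromInt c u⊑ = ⊑up1⇒⊑up0 (⊑-trans u⊑ (≐⇒⊑ (λ z → sym (ext1 c z))))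

    fromInt-≤ : ∀ {u} (c : Plus A X) → int c ⊑ u → fromInt u ≤ᶜ c
    fromInt-≤ c ⊑u = ⊑-trans (up0-antitone ⊑u) (≐⇒⊑ (int0 c))

    fromExt : (ZA A X → D) → Plus A X
    fromExt f = mkPlus (up0 A X (up1 A X f)) (up1 A X f) (up1up0up1 f) (λ _ → refl)

    ≤-fromExt : ∀ {f} (c : Plus A X) → ext c ⊑ f → c ≤ᶜ fromExt f
    ≤-fromExt c ⊑f = ⊑-trans ⊑f up0up1-extensive

    fromExt-≤ : ∀ {f} (c : Plus A X) → f ⊑ ext c → fromExt f ≤ᶜ c
    fromExt-≤ {f} c f⊑ = ⊑-trans (up0-antitone up1-int) (≐⇒⊑ (int0 c))
      where
      up1-int : int c ⊑ up1 A X f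
      up1-int = ⊑-trans (≐⇒⊑ (λ z → sym (ext1 c z))) (up1-antitone f⊑)

    ≤ᶜ-isPartialOrder : IsPartialOrder (_≈⁺_ A X) _≤ᶜ_
    ≤ᶜ-isPartialOrder = record
      { isPreorder = record
        { isEquivalence = record
          { refl  = (λ _ → refl) , (λ _ → refl)
          ; sym   = λ (e , i) → (λ p → sym (e p)) , (λ z → sym (i z))
          ; trans = λ (e , i) (e' , i') → (λ p → trans (e p) (e' p)) , (λ z → trans (i z) (i' z))
          }
        ; reflexive = λ (e , _) → ≐⇒⊑ e
        ; trans     = ⊑-trans
        }
      ; antisym = λ {c} {d} c≤d d≤c → (λ p → antisym (c≤d p) (d≤c p))
                                     , (λ z → antisym (int-antitone d c d≤c z) (int-antitone c d c≤d z))
      }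

    join : {I : Set} (c : I → Plus A X) → Σ (Plus A X) (IsLub _≤ᶜ_ c)
    join c = fromInt (λ z → ⋀ (λ i → int (c i) z))
           , (λ i → ≤-fromInt (c i) (λ z → ⋀-lb _ i))
           , (λ v v≥ → fromInt-≤ v (λ z → ⋀-greatest _ _ (λ i → int-antitone (c i) v (v≥ i) z)))

    meet : {I : Set} (c : I → Plus A X) → Σ (Plus A X) (IsGlb _≤ᶜ_ c)
    meet c = fromExt (λ p → ⋀ (λ i → ext (c i) p))
           , (λ i → fromExt-≤ (c i) (λ p → ⋀-lb _ i))
           , (λ v v≤ → ≤-fromExt v (λ p → ⋀-greatest _ _ (λ i → v≤ i p)))

    isCompleteLattice : IsCompleteLattice (_≈⁺_ A X) _≤ᶜ_
    isCompleteLattice = ≤ᶜ-isPartialOrder , (λ _ → join) , (λ _ → meet)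

  module Operator (X₁ X₂ : Graph A) (R : Graph.Z X₁ → Graph.Z X₂ → D)
    (cond0 : ∀ β α z →
      up1 A X₁ (up0 A X₁ (R0 A R (sing A β (α , z)))) ⊑ R0 A R (sing A β (α , z)))
    (cond1 : ∀ β z' →
      up0 A X₂ (up1 A X₂ (R1 A R (sing A β z'))) ⊑ R1 A R (sing A β z'))
    where
    module C₁ = Concepts X₁
    module C₂ = Concepts X₂
    open Polarity R

    -- Every R⁰[f] is a stable intent of X₁: at each point p, the closure of
    -- R⁰[f] is below that of R⁰[{f(p)/p}], which by cond0 bounds the p-th
    -- conjunct of R⁰[f].
    R0-closed : ∀ f → up1 A X₁ (up0 A X₁ (R0 A R f)) ⊑ R0 A R f
    R0-closed f z = ⋀-greatest _ _ λ p →
      ≤-trans (C₁.up1up0-mono (R0-antitone (sing-⊑ f p)) z)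
        (≤-trans (cond0 (f p) (proj₁ p) (proj₂ p) z) (R0-sing (f p) p z))

    R1-closed : ∀ u → up0 A X₂ (up1 A X₂ (R1 A R u)) ⊑ R1 A R u
    R1-closed u (α , w) = ⋀-greatest _ _ λ z →
      ≤-trans (C₂.up0up1-mono (R1-antitone (sing-⊑ u z)) (α , w))
        (≤-trans (cond1 (u z) z (α , w)) (R1-sing (u z) z α w))

    isPlus : (c : Plus A X₂) → IsPlus A X₁ (up0 A X₁ (R0 A R (ext c)) , R0 A R (ext c))
    isPlus c = C₁.closedInt-isPlus (R0-closed (ext c))

    op : Plus A X₂ → Plus A X₁
    op c = toPlus A X₁ (up0 A X₁ (R0 A R (ext c)) , R0 A R (ext c)) (isPlus c)

    op-mono : ∀ (c d : Plus A X₂) → C₂._≤ᶜ_ c d → C₁._≤ᶜ_ (op c) (op d)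
    op-mono c d c≤d = C₁.≤ᶜ-by-int (op c) (op d) (R0-antitone c≤d)

    R1-element : Plus A X₁ → Plus A X₂
    R1-element v = C₂.closedExt (R1 A R (int v)) (R1-closed (int v))

    op-≤⇒≤-R1-element : ∀ (c : Plus A X₂) (v : Plus A X₁) →
      C₁._≤ᶜ_ (op c) v → C₂._≤ᶜ_ c (R1-element v)
    op-≤⇒≤-R1-element c v op≤v = ⊑R0⇒⊑R1 (C₁.int-antitone (op c) v op≤v)

    ≤-R1-element⇒op-≤ : ∀ (c : Plus A X₂) (v : Plus A X₁) →
      C₂._≤ᶜ_ c (R1-element v) → C₁._≤ᶜ_ (op c) v
    ≤-R1-element⇒op-≤ c v c≤ = C₁.≤ᶜ-by-int (op c) v (⊑R1⇒⊑R0 c≤)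

    -- As a monotone left adjoint, ⟨R⟩ preserves every existing join.
    joinPreserving : CompletelyJoinPreserving (_≤⁺_ A X₂) (_≤⁺_ A X₁) op
    joinPreserving I c s (s≥ , s-least) =
        (λ i → op-mono (c i) s (s≥ i))
      , (λ v v≥ → ≤-R1-element⇒op-≤ s v
           (s-least (R1-element v) (λ i → op-≤⇒≤-R1-element (c i) v (v≥ i))))

open ComplexAlgebra using (module Concepts; module Operator)

mainTheorem1 : (A : CRL) (G : HFrame A) →
    IsCompleteLattice (_≈⁺_ A (HFrame.XS G)) (_≤⁺_ A (HFrame.XS G)) ×
    IsCompleteLattice (_≈⁺_ A (HFrame.XP G)) (_≤⁺_ A (HFrame.XP G)) ×
    Σ ((c : Plus A (HFrame.XS G)) → IsPlus A (HFrame.XP G) (⟨R◆⟩ A G c))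
      (λ wd → CompletelyJoinPreserving (_≤⁺_ A (HFrame.XS G)) (_≤⁺_ A (HFrame.XP G))
                (λ c → toPlus A (HFrame.XP G) (⟨R◆⟩ A G c) (wd c))) ×
    Σ ((d : Plus A (HFrame.XP G)) → IsPlus A (HFrame.XS G) (⟨R◇⟩ A G d))
      (λ wd → CompletelyJoinPreserving (_≤⁺_ A (HFrame.XP G)) (_≤⁺_ A (HFrame.XS G))
                (λ d → toPlus A (HFrame.XS G) (⟨R◇⟩ A G d) (wd d)))
mainTheorem1 A G =
    Concepts.isCompleteLattice A XS
  , Concepts.isCompleteLattice A XP
  , (R◆-Op.isPlus , R◆-Op.joinPreserving)
  , (R◇-Op.isPlus , R◇-Op.joinPreserving)
  where
  open HFrame G
  module R◆-Op = Operator A XP XS R◆ R◆-cond0 R◆-cond1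
  module R◇-Op = Operator A XS XP R◇ R◇-cond0 R◇-cond1
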